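{- Let $p$ be a prime such that $2p-1$ is prime, and let $q$ be a prime with $p < q < 2p-1$ such that each two of $p, q, 2p-1$ form a symmetric pair. Write $q = p + d$ (so that $d \mid p-1$). Then $d = \frac{p-1}{3}$ or $d = \frac{p-1}{2}$.
   Context: Two distinct primes $p$ and $q$ form a symmetric pair if $\gcd(p-1, q-1) = |p-q|$ (an equivalent form of the definition via lattice points in the rectangle with corner $(p/2,q/2)$). A set $\{p,q,2p-1\}$ of this kind is called an extreme symmetric triple. -}

module Defs where

open import Data.Nat using (ℕ; _∸_; ∣_-_∣)
open import Data.Nat.GCD using (gcd)
open import Data.Nat.Primality using (Prime)
open import Data.Product using (_×_)
open import Relation.Binary.PropositionalEquality using (_≡_; _≢_)

SymmetricPair : ℕ → ℕ → Set
SymmetricPair p q = Prime p × Prime q × p ≢ q × gcd (p ∸ 1) (q ∸ 1) ≡ ∣ p - q ∣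

{-# OPTIONS --safe #-}
module Submission where

-- Write p = m + 1, so q = m + d + 1 and 2p − 1 = 2m + 1. The pair (p, q) gives d ∣ m, and the
-- pair (q, 2p − 1) gives m − d ∣ m + d. With m = k d this says k − 1 ∣ k + 1, hence k − 1 ∣ 2,
-- so k is 2 or 3.

open import Defs
open import Data.Nat using (ℕ; NonZero; ≢-nonZero; zero; suc; s≤s; _+_; _*_; _∸_; _<_; _≤_; ∣_-_∣)
open import Data.Nat.Properties
open import Data.Nat.Divisibility
open import Data.Nat.GCD using (gcd[m,n]∣m)
open import Data.Nat.Primality using (Prime)
open import Data.Sum using (_⊎_; inj₁; inj₂)
open import Data.Product using (_,_)
open import Relation.Binary.PropositionalEquality
open import Relation.Nullary using (contradiction)

SymmetricPair⇒∣-∣∣∸1 : ∀ {p q} → SymmetricPair p q → ∣ p - q ∣ ∣ p ∸ 1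
SymmetricPair⇒∣-∣∣∸1 {p} {q} (_ , _ , _ , gcd≡) = subst (_∣ p ∸ 1) gcd≡ (gcd[m,n]∣m (p ∸ 1) (q ∸ 1))

∣2⇒≡1⊎≡2 : ∀ {n} → n ∣ 2 → n ≡ 1 ⊎ n ≡ 2
∣2⇒≡1⊎≡2 {zero}                n∣2 = contradiction (0∣⇒≡0 n∣2) λ ()
∣2⇒≡1⊎≡2 {1}                   _   = inj₁ refl
∣2⇒≡1⊎≡2 {2}                   _   = inj₂ refl
∣2⇒≡1⊎≡2 {suc (suc (suc n))} n∣2 = contradiction (∣⇒≤ n∣2) λ { (s≤s (s≤s ())) }

∸1∣suc⇒≡2⊎≡3 : ∀ {k} → k ∸ 1 ∣ suc k → k ≡ 2 ⊎ k ≡ 3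
∸1∣suc⇒≡2⊎≡3 {zero}  0∣1 = contradiction (0∣⇒≡0 0∣1) λ ()
∸1∣suc⇒≡2⊎≡3 {suc n} n∣2+n with ∣2⇒≡1⊎≡2 (∣m+n∣m⇒∣n (subst (n ∣_) (+-comm 2 n) n∣2+n) ∣-refl)
... | inj₁ refl = inj₁ refl
... | inj₂ refl = inj₂ refl

∣∧∸∣+⇒3*≡⊎2*≡ : ∀ {d m} .{{_ : NonZero d}} → d ∣ m → m ∸ d ∣ m + d → 3 * d ≡ m ⊎ 2 * d ≡ m
∣∧∸∣+⇒3*≡⊎2*≡ {d} (divides k refl) m∸d∣m+d
  with ∸1∣suc⇒≡2⊎≡3 {k} (*-cancelʳ-∣ d (subst₂ _∣_ m∸d≡ m+d≡ m∸d∣m+d))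
  where
  m∸d≡ : k * d ∸ d ≡ (k ∸ 1) * d
  m∸d≡ = trans (cong (k * d ∸_) (sym (*-identityˡ d))) (sym (*-distribʳ-∸ d k 1))
  m+d≡ : k * d + d ≡ suc k * d
  m+d≡ = +-comm (k * d) d
... | inj₁ refl = inj₂ refl
... | inj₂ refl = inj₁ refl

2*[1+m]∸1≡1+m+m : ∀ m → 2 * suc m ∸ 1 ≡ suc m + m
2*[1+m]∸1≡1+m+m m = trans (+-suc m (m + 0)) (cong (λ n → suc (m + n)) (+-identityʳ m))

theorem1 : (p q d : ℕ) → Prime p → Prime (2 * p ∸ 1) → Prime q →
    p < q → q < 2 * p ∸ 1 →
    SymmetricPair p q → SymmetricPair p (2 * p ∸ 1) → SymmetricPair q (2 * p ∸ 1) →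
    q ≡ p + d →
    (3 * d ≡ p ∸ 1) ⊎ (2 * d ≡ p ∸ 1)
theorem1 zero    _ _ _ _ _ _   ()  _  _ _  _
theorem1 (suc m) _ d _ _ _ p<q q<r pq _ qr refl =
  ∣∧∸∣+⇒3*≡⊎2*≡ {{d≢0}} d∣m (subst (_∣ m + d) ∣q-r∣≡m∸d (SymmetricPair⇒∣-∣∣∸1 qr))
  where
  open ≡-Reasoning
  d≢0 : NonZero d
  d≢0 = ≢-nonZero λ { refl → <-irrefl (sym (+-identityʳ (suc m))) p<q }
  d∣m : d ∣ m
  d∣m = subst (_∣ m) (∣m-m+n∣≡n m d) (SymmetricPair⇒∣-∣∣∸1 pq)
  d≤m : d ≤ m
  d≤m = <⇒≤ (+-cancelˡ-< (suc m) d m (subst (suc m + d <_) (2*[1+m]∸1≡1+m+m m) q<r))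
  ∣q-r∣≡m∸d : ∣ suc m + d - 2 * suc m ∸ 1 ∣ ≡ m ∸ d
  ∣q-r∣≡m∸d = begin
    ∣ suc m + d - 2 * suc m ∸ 1 ∣ ≡⟨ cong (∣ suc m + d -_∣) (2*[1+m]∸1≡1+m+m m) ⟩
    ∣ suc m + d - suc m + m ∣     ≡⟨ ∣m+n-m+o∣≡∣n-o∣ (suc m) d m ⟩
    ∣ d - m ∣                     ≡⟨ m≤n⇒∣m-n∣≡n∸m d≤m ⟩
    m ∸ d                         ∎
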